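{- For all integers $k\ge 1$ and $t\ge 2$, $\mathrm{rl}_k(D(1,2,\ldots,t))\ge \frac t2 k^2+\frac12$.
   Context: For a finite set $D=\{d_1<\dots<d_m\}$ of positive integers, the distance graph $D(d_1,\dots,d_m)$ has vertex set $\mathbb{Z}$, two distinct integers $i,j$ being adjacent iff $|i-j|\in D$. For a connected graph $G$ with graph distance $d(\cdot,\cdot)$ and an integer $k\ge 1$, a radio $k$-labeling of $G$ is a map $c:V(G)\to\mathbb{Z}_{\ge 0}$ such that $|c(u)-c(v)|\geq k+1-d(u,v)$ for all distinct vertices $u,v$. Its span is $\max\{c(x)-c(y): x,y\in V(G)\}$ (a supremum for infinite graphs), and the radio $k$-labeling number $\mathrm{rl}_k(G)$ is the minimum span over all radio $k$-labelings of $G$. -}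

module Defs where

open import Data.Nat using (ℕ; zero; suc; _+_; _*_; _≤_; _<_)
open import Data.Integer as ℤ using (ℤ; ∣_∣; _-_)
open import Data.List using (List; map; upTo)
open import Data.List.Membership.Propositional using (_∈_)
open import Relation.Nullary using (¬_)
open import Relation.Binary.PropositionalEquality using (_≡_)

DistAdj : List ℕ → ℤ → ℤ → Set
DistAdj D i j = ∣ i - j ∣ ∈ D

oneTo : ℕ → List ℕ
oneTo t = map suc (upTo t)

data Walk (Adj : ℤ → ℤ → Set) : ℤ → ℤ → ℕ → Set where
  here : ∀ {u} → Walk Adj u u zero
  step : ∀ {u w v n} → Adj u w → Walk Adj w v n → Walk Adj u v (suc n)

IsDist : (ℤ → ℤ → Set) → ℤ → ℤ → ℕ → Set
IsDist Adj u v n = Walk Adj u v n × (∀ m → m < n → ¬ Walk Adj u v m)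
  where open import Data.Product using (_×_)

IsRadioLabeling : (ℤ → ℤ → Set) → ℕ → (ℤ → ℕ) → Set
IsRadioLabeling Adj k c =
  ∀ u v → ¬ (u ≡ v) → ∀ n → IsDist Adj u v n →
    k + 1 ≤ ∣ ℤ.+ c u - ℤ.+ c v ∣ + n

-- "span(c) ≥ t/2 k² + 1/2": the span is the supremum of c(x) - c(y), a
-- supremum of integers, so it is ≥ the bound iff some difference is,
-- i.e. 2(c(x) - c(y)) ≥ t k² + 1.
SpanAtLeastHalf : (ℤ → ℕ) → ℕ → Set
SpanAtLeastHalf c N = Σ ℤ λ x → Σ ℤ λ y → 2 * c y + N ≤ 2 * c x
  where open import Data.Product using (Σ)

-- Let N = kt + 1 and call ⌊d/t⌋ the level of a vertex i of the window 0, …, N − 1, where d is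
-- the distance from i to the nearer end of the window.  Window vertices i < j of levels a and b
-- satisfy (a + b)t + (j − i) ≤ kt, so they are at graph distance at most k − a − b and the radio
-- condition forces |c i − c j| ≥ a + b + 1.  With weight 2·level + 1 this says that the intervals
-- of radius weight centred at twice the labels are pairwise disjoint, so twice the span is at
-- least twice the total weight minus the weights of the lowest- and highest-labelled vertices
-- (at most 2k together).  Pairing each vertex near one end with one near the other end, the total
-- weight is at least (tk² + 2k + 1)/2.

module Submission where

open import Defs
open import Data.Nat using (ℕ; zero; suc; _+_; _*_; _∸_; _≤_; _<_; _≤?_; _⊓_; z≤n; s≤s; ∣_-_∣; NonZero; >-nonZero⁻¹)
open import Data.Nat.Properties
open import Data.Nat.DivMod using (_/_; _%_; m≡m%n+[m/n]*n; m%n<n; m/n*n≤m; m*n/n≡m; /-monoˡ-≤)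
open import Data.Nat.ListAction using (sum)
open import Data.Nat.ListAction.Properties using (sum-++; sum-↭)
import Data.Nat.Tactic.RingSolver as ℕ-Solver
open import Data.Integer as ℤ using (ℤ)
import Data.Integer.Properties as ℤ
import Data.Integer.Tactic.RingSolver as ℤ-Solver
open import Data.List using (List; []; _∷_; [_]; _++_; _∷ʳ_; map; upTo; length)
open import Data.List.Properties using (upTo-∷ʳ; map-++; length-upTo)
open import Data.List.Membership.Propositional using (_∈_)
open import Data.List.Membership.Propositional.Properties using (∈-map⁺; ∈-map⁻; ∈-upTo⁺; ∈-upTo⁻)
open import Data.List.Relation.Unary.All as All using (All; []; _∷_)
open import Data.List.Relation.Unary.Any using (here; there)
open import Data.List.Relation.Unary.AllPairs using ([]; _∷_)
open import Data.List.Relation.Unary.Linked using (Linked; []; [-]; _∷_)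
open import Data.List.Relation.Unary.Unique.Propositional using (Unique)
open import Data.List.Relation.Unary.Unique.Propositional.Properties using (upTo⁺)
open import Data.List.Relation.Binary.Permutation.Propositional using (_↭_; ↭⇒↭ₛ; ↭-sym)
open import Data.List.Relation.Binary.Permutation.Propositional.Properties using (∈-resp-↭; ↭-length; map⁺)
import Data.List.Relation.Binary.Permutation.Setoid.Properties as PermutationSetoid
import Data.List.Sort as Sort
import Relation.Binary.Construct.On as On
open import Data.Product using (∃-syntax; _×_; _,_)
open import Data.Sum using (inj₁; inj₂)
open import Data.Empty using (⊥-elim)
open import Function using (_∘_)
open import Relation.Binary using (tri<; tri≈; tri>)
open import Relation.Binary.PropositionalEquality
  using (_≡_; _≢_; refl; sym; trans; cong; cong₂; subst; subst₂; setoid; module ≡-Reasoning)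
open import Relation.Nullary using (¬_; yes; no)

sumUpTo : ℕ → (ℕ → ℕ) → ℕ
sumUpTo n f = sum (map f (upTo n))

sumUpTo-suc : ∀ n f → sumUpTo (suc n) f ≡ sumUpTo n f + f n
sumUpTo-suc n f = begin
  sum (map f (upTo (suc n)))       ≡⟨ cong (sum ∘ map f) (upTo-∷ʳ n) ⟨
  sum (map f (upTo n ∷ʳ n))        ≡⟨ cong sum (map-++ f (upTo n) [ n ]) ⟩
  sum (map f (upTo n) ++ [ f n ])  ≡⟨ sum-++ (map f (upTo n)) [ f n ] ⟩
  sumUpTo n f + (f n + 0)          ≡⟨ cong (sumUpTo n f +_) (+-identityʳ (f n)) ⟩
  sumUpTo n f + f n                ∎
  where open ≡-Reasoning

sumUpTo-+ : ∀ a b f → sumUpTo (a + b) f ≡ sumUpTo a f + sumUpTo b (λ s → f (a + s))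
sumUpTo-+ a zero f = trans (cong (λ n → sumUpTo n f) (+-identityʳ a)) (sym (+-identityʳ _))
sumUpTo-+ a (suc b) f = begin
  sumUpTo (a + suc b) f                      ≡⟨ cong (λ n → sumUpTo n f) (+-suc a b) ⟩
  sumUpTo (suc (a + b)) f                    ≡⟨ sumUpTo-suc (a + b) f ⟩
  sumUpTo (a + b) f + f (a + b)              ≡⟨ cong (_+ f (a + b)) (sumUpTo-+ a b f) ⟩
  sumUpTo a f + sumUpTo b g + f (a + b)      ≡⟨ +-assoc (sumUpTo a f) (sumUpTo b g) (g b) ⟩
  sumUpTo a f + (sumUpTo b g + g b)          ≡⟨ cong (sumUpTo a f +_) (sumUpTo-suc b g) ⟨
  sumUpTo a f + sumUpTo (suc b) g            ∎
  where
  open ≡-Reasoning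
  g : ℕ → ℕ
  g s = f (a + s)

sumUpTo-distrib-+ : ∀ n f g → sumUpTo n (λ i → f i + g i) ≡ sumUpTo n f + sumUpTo n g
sumUpTo-distrib-+ zero f g = refl
sumUpTo-distrib-+ (suc n) f g = begin
  sumUpTo (suc n) (λ i → f i + g i)              ≡⟨ sumUpTo-suc n (λ i → f i + g i) ⟩
  sumUpTo n (λ i → f i + g i) + (f n + g n)      ≡⟨ cong (_+ (f n + g n)) (sumUpTo-distrib-+ n f g) ⟩
  sumUpTo n f + sumUpTo n g + (f n + g n)        ≡⟨ +-+-comm (sumUpTo n f) (sumUpTo n g) (f n) (g n) ⟩
  (sumUpTo n f + f n) + (sumUpTo n g + g n)      ≡⟨ cong₂ _+_ (sumUpTo-suc n f) (sumUpTo-suc n g) ⟨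
  sumUpTo (suc n) f + sumUpTo (suc n) g          ∎
  where
  open ≡-Reasoning
  +-+-comm : ∀ a b c d → a + b + (c + d) ≡ (a + c) + (b + d)
  +-+-comm = ℕ-Solver.solve-∀

n*a≤sumUpTo : ∀ n a f → (∀ i → i < n → a ≤ f i) → n * a ≤ sumUpTo n f
n*a≤sumUpTo zero a f _ = z≤n
n*a≤sumUpTo (suc n) a f a≤f = begin
  suc n * a             ≡⟨ +-comm a (n * a) ⟩
  n * a + a             ≤⟨ +-mono-≤ (n*a≤sumUpTo n a f (λ i i<n → a≤f i (m≤n⇒m≤1+n i<n))) (a≤f n ≤-refl) ⟩
  sumUpTo n f + f n     ≡⟨ sumUpTo-suc n f ⟨
  sumUpTo (suc n) f     ∎
  where open ≤-Reasoning

module _ {A : Set} (c G : A → ℕ) where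

  -- G u is the radius of an interval centred at 2 c u; u precedes v when the two intervals do not overlap.
  Precedes : A → A → Set
  Precedes u v = 2 * c u + G u + G v ≤ 2 * c v

  private
    extend : ∀ {a b e f g h s} → a + g + h ≤ b → b + 2 * s ≤ e + f + h → a + 2 * (g + s) ≤ e + f + g
    extend {a} {b} {e} {f} {g} {h} {s} a+g+h≤b b+2s≤e+f+h = +-cancelʳ-≤ h _ _ (begin
      a + 2 * (g + s) + h          ≡⟨ regroupˡ a g h s ⟩
      (a + g + h) + (g + 2 * s)    ≤⟨ +-monoˡ-≤ (g + 2 * s) a+g+h≤b ⟩
      b + (g + 2 * s)              ≡⟨ regroupʳ b g s ⟩
      (b + 2 * s) + g              ≤⟨ +-monoˡ-≤ g b+2s≤e+f+h ⟩
      e + f + h + g                ≡⟨ regroup e f h g ⟩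
      e + f + g + h                ∎)
      where
      open ≤-Reasoning
      regroupˡ : ∀ a g h s → a + 2 * (g + s) + h ≡ (a + g + h) + (g + 2 * s)
      regroupˡ = ℕ-Solver.solve-∀
      regroupʳ : ∀ b g s → b + (g + 2 * s) ≡ (b + 2 * s) + g
      regroupʳ = ℕ-Solver.solve-∀
      regroup : ∀ e f h g → e + f + h + g ≡ e + f + g + h
      regroup = ℕ-Solver.solve-∀

  chain-spread : ∀ {u v ws} → Linked Precedes (u ∷ v ∷ ws) →
    ∃[ z ] z ∈ v ∷ ws × 2 * c u + 2 * sum (map G (u ∷ v ∷ ws)) ≤ 2 * c z + G z + G u
  chain-spread {u} {v} {[]} (u≺v ∷ [-]) =
    v , here refl ,
    extend {a = 2 * c u} {e = 2 * c v} {g = G u} {h = G v} u≺v (≤-reflexive (double (2 * c v) (G v)))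
    where
    double : ∀ a g → a + 2 * (g + 0) ≡ a + g + g
    double = ℕ-Solver.solve-∀
  chain-spread {u} {ws = w ∷ ws} (u≺v ∷ chain) with chain-spread chain
  ... | z , z∈ , spread = z , there z∈ , extend {e = 2 * c z} {g = G u} u≺v spread

  Spread : List A → Set
  Spread ws = ∃[ x ] ∃[ y ] x ≢ y × x ∈ ws × y ∈ ws ×
    2 * c y + 2 * sum (map G ws) ≤ 2 * c x + G x + G y

  chain⇒spread : ∀ {ws} → Linked Precedes ws → Unique ws → 2 ≤ length ws → Spread ws
  chain⇒spread {_ ∷ []} _ _ (s≤s ())
  chain⇒spread {u ∷ v ∷ ws} chain (u∉vws ∷ _) _ with chain-spread chain
  ... | z , z∈vws , spread =
    z , u , (λ z≡u → All.lookup u∉vws z∈vws (sym z≡u)) , there z∈vws , here refl , spread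

  Spread-resp-↭ : ∀ {ws vs} → ws ↭ vs → Spread ws → Spread vs
  Spread-resp-↭ σ (x , y , x≢y , x∈ , y∈ , spread) = x , y , x≢y , ∈-resp-↭ σ x∈ , ∈-resp-↭ σ y∈ ,
    subst (λ s → 2 * c y + 2 * s ≤ 2 * c x + G x + G y) (sum-↭ (map⁺ G σ)) spread

  separated⇒Precedes : ∀ {u v} → c u ≤ c v → G u + G v ≤ 2 * ∣ c u - c v ∣ → Precedes u v
  separated⇒Precedes {u} {v} cu≤cv sep = begin
    2 * c u + G u + G v          ≡⟨ +-assoc (2 * c u) (G u) (G v) ⟩
    2 * c u + (G u + G v)        ≤⟨ +-monoʳ-≤ (2 * c u) sep ⟩
    2 * c u + 2 * ∣ c u - c v ∣  ≡⟨ *-distribˡ-+ 2 (c u) _ ⟨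
    2 * (c u + ∣ c u - c v ∣)    ≡⟨ cong (λ d → 2 * (c u + d)) (m≤n⇒∣m-n∣≡n∸m cu≤cv) ⟩
    2 * (c u + (c v ∸ c u))      ≡⟨ cong (2 *_) (m+[n∸m]≡n cu≤cv) ⟩
    2 * c v                      ∎
    where open ≤-Reasoning

  module _ (vs : List A)
    (separated : ∀ {u v} → u ∈ vs → v ∈ vs → u ≢ v → G u + G v ≤ 2 * ∣ c u - c v ∣) where

    open Sort (On.decTotalOrder ≤-decTotalOrder c) using (sort; sort-↭; sort-↗)

    private
      sorted⇒chain : ∀ {ws} → All (_∈ vs) ws → Unique ws → Linked (λ u v → c u ≤ c v) ws →
        Linked Precedes ws
      sorted⇒chain [] [] [] = []
      sorted⇒chain (_ ∷ []) _ [-] = [-]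
      sorted⇒chain (u∈ ∷ v∈ ∷ ws∈) (u∉vws ∷ unique) (cu≤cv ∷ sorted) =
        separated⇒Precedes cu≤cv (separated u∈ v∈ (All.head u∉vws)) ∷ sorted⇒chain (v∈ ∷ ws∈) unique sorted

    label-spread : Unique vs → 2 ≤ length vs → Spread vs
    label-spread unique 2≤∣vs∣ = Spread-resp-↭ σ
      (chain⇒spread (sorted⇒chain (All.tabulate (∈-resp-↭ σ)) unique′ (sort-↗ vs)) unique′
                    (subst (2 ≤_) (sym (↭-length σ)) 2≤∣vs∣))
      where
      σ : sort vs ↭ vs
      σ = sort-↭ vs
      unique′ : Unique (sort vs)
      unique′ = PermutationSetoid.Unique-resp-↭ (setoid A) (↭⇒↭ₛ (↭-sym σ)) unique

m*n≤1+a+b⇒m≤1+a/n+b/n : ∀ m n a b .{{_ : NonZero n}} → m * n ≤ suc (a + b) → m ≤ suc (a / n + b / n)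
m*n≤1+a+b⇒m≤1+a/n+b/n m n a b mn≤1+a+b = begin
  m                        ≤⟨ m≤n+m∸n m (suc q) ⟩
  suc q + (m ∸ suc q)      ≤⟨ +-monoʳ-≤ (suc q) rest≤b/n ⟩
  suc (q + b / n)          ∎
  where
  open ≤-Reasoning
  q = a / n
  a<[1+q]n : a < suc q * n
  a<[1+q]n = subst (_< suc q * n) (sym (m≡m%n+[m/n]*n a n)) (+-monoˡ-< (q * n) (m%n<n a n))
  rest*n≤b : (m ∸ suc q) * n ≤ b
  rest*n≤b = begin
    (m ∸ suc q) * n          ≡⟨ *-distribʳ-∸ n m (suc q) ⟩
    m * n ∸ suc q * n        ≤⟨ ∸-mono mn≤1+a+b a<[1+q]n ⟩
    suc (a + b) ∸ suc a      ≡⟨ m+n∸m≡n a b ⟩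
    b                        ∎
  rest≤b/n : m ∸ suc q ≤ b / n
  rest≤b/n = subst (_≤ b / n) (m*n/n≡m (m ∸ suc q) n) (/-monoˡ-≤ n rest*n≤b)

parity-arith : ∀ m b t → b < 2 → 1 ≤ t →
  t * ((b + m * 2) * (b + m * 2)) + 1 + 2 * (b + m * 2) ≤ 2 * (m * t * (2 * m) + (b * t + 1) * suc (2 * m))
parity-arith m zero t _ _ = ≤-trans (m≤m+n _ 1) (≤-reflexive (expand m t))
  where
  expand : ∀ m t → t * ((0 + m * 2) * (0 + m * 2)) + 1 + 2 * (0 + m * 2) + 1 ≡
                   2 * (m * t * (2 * m) + (0 * t + 1) * suc (2 * m))
  expand = ℕ-Solver.solve-∀
parity-arith m (suc (suc _)) _ (s≤s (s≤s ())) _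
parity-arith m (suc zero) (suc t) _ _ = ≤-trans (m≤m+n _ t) (≤-reflexive (expand m t))
  where
  expand : ∀ m t → suc t * ((1 + m * 2) * (1 + m * 2)) + 1 + 2 * (1 + m * 2) + t ≡
                   2 * (m * suc t * (2 * m) + (1 * suc t + 1) * suc (2 * m))
  expand = ℕ-Solver.solve-∀

wlog-< : ∀ {n} (P : ℕ → ℕ → Set) → (∀ {i j} → P i j → P j i) →
  (∀ {i j} → i < j → j < n → P i j) → ∀ {i j} → i < n → j < n → i ≢ j → P i j
wlog-< P P-sym P-< {i} {j} i<n j<n i≢j with <-cmp i j
... | tri< i<j _ _ = P-< i<j j<n
... | tri≈ _ i≡j _ = ⊥-elim (i≢j i≡j)
... | tri> _ _ j<i = P-sym (P-< j<i i<n)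

∣+m-+n∣≡∣m-n∣ : ∀ m n → ℤ.∣ ℤ.+ m ℤ.- ℤ.+ n ∣ ≡ ∣ m - n ∣
∣+m-+n∣≡∣m-n∣ m n rewrite ℤ.[+m]-[+n]≡m⊖n m n with ≤-total m n
... | inj₁ m≤n = trans (ℤ.∣⊖∣-≤ m≤n) (sym (m≤n⇒∣m-n∣≡n∸m m≤n))
... | inj₂ n≤m = trans (ℤ.∣m⊖n∣≡∣n⊖m∣ m n) (trans (ℤ.∣⊖∣-≤ n≤m) (sym (m≤n⇒∣n-m∣≡n∸m n≤m)))

∣+m-+[m+n]∣≡n : ∀ m n → ℤ.∣ ℤ.+ m ℤ.- ℤ.+ (m + n) ∣ ≡ n
∣+m-+[m+n]∣≡n m n = trans (∣+m-+n∣≡∣m-n∣ m (m + n)) (∣m-m+n∣≡n m n)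

module _ (t : ℕ) where

  private
    Adj : ℤ → ℤ → Set
    Adj = DistAdj (oneTo t)

  ∈-oneTo⁻ : ∀ {s} → s ∈ oneTo t → s ≤ t
  ∈-oneTo⁻ s∈ with ∈-map⁻ suc s∈
  ... | _ , r∈ , refl = ∈-upTo⁻ r∈

  adjacent-forward : ∀ i {s} → 1 ≤ s → s ≤ t → Adj (ℤ.+ i) (ℤ.+ (i + s))
  adjacent-forward i {suc s} _ s<t = subst (_∈ oneTo t) (sym (∣+m-+[m+n]∣≡n i (suc s))) (∈-map⁺ suc (∈-upTo⁺ s<t))

  walk-displacement : ∀ {u v n} → Walk Adj u v n → ℤ.∣ u ℤ.- v ∣ ≤ n * t
  walk-displacement {u} here rewrite ℤ.+-inverseʳ u = z≤n
  walk-displacement {u} {v} {suc n} (step {w = w} u~w walk) = begin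
    ℤ.∣ u ℤ.- v ∣                      ≡⟨ cong ℤ.∣_∣ (telescope u w v) ⟨
    ℤ.∣ (u ℤ.- w) ℤ.+ (w ℤ.- v) ∣      ≤⟨ ℤ.∣i+j∣≤∣i∣+∣j∣ (u ℤ.- w) (w ℤ.- v) ⟩
    ℤ.∣ u ℤ.- w ∣ + ℤ.∣ w ℤ.- v ∣      ≤⟨ +-mono-≤ (∈-oneTo⁻ u~w) (walk-displacement walk) ⟩
    t + n * t                          ∎
    where
    open ≤-Reasoning
    telescope : ∀ u w v → (u ℤ.- w) ℤ.+ (w ℤ.- v) ≡ u ℤ.- v
    telescope = ℤ-Solver.solve-∀

  module _ .{{_ : NonZero t}} where

    private
      hop : ∀ {i s r D n} → 1 ≤ s → s ≤ t → s + r ≡ D →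
        Walk Adj (ℤ.+ (i + s)) (ℤ.+ (i + s + r)) n → Walk Adj (ℤ.+ i) (ℤ.+ (i + D)) (suc n)
      hop {i} {s} {r} {n = n} 1≤s s≤t refl walk =
        step (adjacent-forward i 1≤s s≤t) (subst (λ j → Walk Adj (ℤ.+ (i + s)) (ℤ.+ j) n) (+-assoc i s r) walk)

    forward-walk : ∀ n i D → n ≤ D → D ≤ n * t → Walk Adj (ℤ.+ i) (ℤ.+ (i + D)) n
    forward-walk zero i D _ D≤0 rewrite n≤0⇒n≡0 D≤0 | +-identityʳ i = here
    forward-walk (suc n) i D n<D D≤[1+n]t with D ∸ n ≤? t
    ... | yes D∸n≤t =
      hop (m<n⇒0<n∸m n<D) D∸n≤t (m∸n+n≡m (<⇒≤ n<D)) (forward-walk n _ n ≤-refl (m≤m*n n t))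
    ... | no D∸n≰t =
      hop (>-nonZero⁻¹ t) ≤-refl (m+[n∸m]≡n t≤D) (forward-walk n _ (D ∸ t) n≤D∸t D∸t≤nt)
      where
      t+n<D : t + n < D
      t+n<D = subst (t + n <_) (m∸n+n≡m (<⇒≤ n<D)) (+-monoˡ-< n (≰⇒> D∸n≰t))
      t≤D : t ≤ D
      t≤D = ≤-trans (m≤m+n t n) (<⇒≤ t+n<D)
      n≤D∸t : n ≤ D ∸ t
      n≤D∸t = m+n≤o⇒m≤o∸n n (subst (_≤ D) (+-comm t n) (<⇒≤ t+n<D))
      D∸t≤nt : D ∸ t ≤ n * t
      D∸t≤nt = subst (D ∸ t ≤_) (m+n∸m≡n t (n * t)) (∸-monoˡ-≤ t D≤[1+n]t)

    least-multiple-≥ : ∀ {D} M → D ≤ M * t →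
      ∃[ n ] n ≤ M × D ≤ n * t × (∀ m → m < n → m * t < D)
    least-multiple-≥ zero D≤0 = 0 , ≤-refl , D≤0 , λ _ ()
    least-multiple-≥ {D} (suc M) D≤[1+M]t with D ≤? M * t
    ... | yes D≤Mt with least-multiple-≥ M D≤Mt
    ...   | n , n≤M , D≤nt , least = n , m≤n⇒m≤1+n n≤M , D≤nt , least
    least-multiple-≥ {D} (suc M) D≤[1+M]t | no D≰Mt =
      suc M , ≤-refl , D≤[1+M]t , λ m m<1+M → ≤-<-trans (*-monoˡ-≤ t (≤-pred m<1+M)) (≰⇒> D≰Mt)

    forward-distance : ∀ i {D} M → 1 ≤ D → D ≤ M * t →
      ∃[ n ] n ≤ M × IsDist Adj (ℤ.+ i) (ℤ.+ (i + D)) n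
    forward-distance i {D} M 1≤D D≤Mt with least-multiple-≥ M D≤Mt
    ... | n , n≤M , D≤nt , least =
      n , n≤M , forward-walk n i D (least⇒≤ n least) D≤nt , no-shorter
      where
      least⇒≤ : ∀ n → (∀ m → m < n → m * t < D) → n ≤ D
      least⇒≤ zero    _     = z≤n
      least⇒≤ (suc m) least = ≤-<-trans (m≤m*n m t) (least m ≤-refl)
      no-shorter : ∀ m → m < n → ¬ Walk Adj (ℤ.+ i) (ℤ.+ (i + D)) m
      no-shorter m m<n walk =
        <⇒≱ (least m m<n) (subst (_≤ m * t) (∣+m-+[m+n]∣≡n i D) (walk-displacement walk))

    radio-forward : ∀ {k} (c : ℤ → ℕ) → IsRadioLabeling Adj k c → ∀ i {D} M → 1 ≤ D → D ≤ M * t →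
      k + 1 ≤ ∣ c (ℤ.+ i) - c (ℤ.+ (i + D)) ∣ + M
    radio-forward {k} c radio i {D} M 1≤D D≤Mt with forward-distance i M 1≤D D≤Mt
    ... | n , n≤M , dist = begin
      k + 1                                          ≤⟨ radio (ℤ.+ i) (ℤ.+ (i + D)) i≢i+D n dist ⟩
      ℤ.∣ ℤ.+ c (ℤ.+ i) ℤ.- ℤ.+ c (ℤ.+ (i + D)) ∣ + n  ≡⟨ cong (_+ n) (∣+m-+n∣≡∣m-n∣ (c (ℤ.+ i)) (c (ℤ.+ (i + D)))) ⟩
      ∣ c (ℤ.+ i) - c (ℤ.+ (i + D)) ∣ + n             ≤⟨ +-monoʳ-≤ _ n≤M ⟩
      ∣ c (ℤ.+ i) - c (ℤ.+ (i + D)) ∣ + M             ∎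
      where
      open ≤-Reasoning
      i≢i+D : ¬ (ℤ.+ i ≡ ℤ.+ (i + D))
      i≢i+D i≡i+D = <⇒≢ (m<m+n i 1≤D) (ℤ.+-injective i≡i+D)

module Window (k t : ℕ) .{{_ : NonZero t}} where

  N : ℕ
  N = suc (k * t)

  depth : ℕ → ℕ
  depth i = i ⊓ (N ∸ suc i)

  level : ℕ → ℕ
  level i = depth i / t

  weight : ℕ → ℕ
  weight i = suc (2 * level i)

  level*t≤depth : ∀ i → level i * t ≤ depth i
  level*t≤depth i = m/n*n≤m (depth i) t

  ≤-depth : ∀ {x i} → x ≤ i → x + suc i ≤ N → x ≤ depth i
  ≤-depth {x} x≤i x+1+i≤N = ⊓-glb x≤i (m+n≤o⇒m≤o∸n x x+1+i≤N)

  level*t≤ : ∀ i → level i * t ≤ i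
  level*t≤ i = ≤-trans (level*t≤depth i) (m⊓n≤m i (N ∸ suc i))

  level*t≤N∸ : ∀ i → level i * t ≤ N ∸ suc i
  level*t≤N∸ i = ≤-trans (level*t≤depth i) (m⊓n≤n i (N ∸ suc i))

  levels-apart : ∀ {i j} → i < j → j < N → (level i + level j) * t + (j ∸ i) ≤ k * t
  levels-apart {i} {j} i<j j<N = begin
    (level i + level j) * t + (j ∸ i)        ≡⟨ cong (_+ (j ∸ i)) (*-distribʳ-+ t (level i) (level j)) ⟩
    level i * t + level j * t + (j ∸ i)      ≡⟨ swap₂₃ (level i * t) (level j * t) (j ∸ i) ⟩
    level i * t + (j ∸ i) + level j * t      ≤⟨ +-mono-≤ (+-monoˡ-≤ (j ∸ i) (level*t≤ i)) (level*t≤N∸ j) ⟩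
    i + (j ∸ i) + (k * t ∸ j)                ≡⟨ cong (_+ (k * t ∸ j)) (m+[n∸m]≡n (<⇒≤ i<j)) ⟩
    j + (k * t ∸ j)                          ≡⟨ m+[n∸m]≡n (≤-pred j<N) ⟩
    k * t                                    ∎
    where
    open ≤-Reasoning
    swap₂₃ : ∀ a b d → a + b + d ≡ a + d + b
    swap₂₃ = ℕ-Solver.solve-∀

  levels<k : ∀ {i j} → i < j → j < N → level i + level j < k
  levels<k {i} {j} i<j j<N = *-cancelʳ-< t (level i + level j) k (begin-strict
    (level i + level j) * t                  <⟨ m<m+n _ (m<n⇒0<n∸m i<j) ⟩
    (level i + level j) * t + (j ∸ i)        ≤⟨ levels-apart i<j j<N ⟩
    k * t                                    ∎)
    where open ≤-Reasoning

  weight-+ : ∀ i j → weight i + weight j ≡ 2 * suc (level i + level j)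
  weight-+ i j = double-suc (level i) (level j)
    where
    double-suc : ∀ a b → suc (2 * a) + suc (2 * b) ≡ 2 * suc (a + b)
    double-suc = ℕ-Solver.solve-∀

  <⇒weights≤2k : ∀ {i j} → i < j → j < N → weight i + weight j ≤ 2 * k
  <⇒weights≤2k {i} {j} i<j j<N = subst (_≤ 2 * k) (sym (weight-+ i j)) (*-monoʳ-≤ 2 (levels<k i<j j<N))

  ≢⇒weights≤2k : ∀ {i j} → i < N → j < N → i ≢ j → weight i + weight j ≤ 2 * k
  ≢⇒weights≤2k = wlog-< (λ i j → weight i + weight j ≤ 2 * k)
    (λ {i} {j} → subst (_≤ 2 * k) (+-comm (weight i) (weight j))) <⇒weights≤2k

  -- With k = b + 2m, the window consists of blocks of sizes L, C, L; vertex s of the left block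
  -- is paired with vertex L + C + s of the right one.
  private
    m = k / 2
    b = k % 2
    L = m * t
    C = b * t + 1

    N≡L+C+L : N ≡ L + C + L
    N≡L+C+L = trans (cong (λ x → suc (x * t)) (m≡m%n+[m/n]*n k 2)) (split b m t)
      where
      split : ∀ b m t → suc ((b + m * 2) * t) ≡ m * t + (b * t + 1) + m * t
      split = ℕ-Solver.solve-∀

    outer-weights : ∀ s → s < L → 2 * m ≤ weight s + weight (L + C + s)
    outer-weights s s<L = subst (2 * m ≤_) (sym (weight-+ s (L + C + s))) (*-monoʳ-≤ 2 (begin
      m                                       ≤⟨ m*n≤1+a+b⇒m≤1+a/n+b/n m t s (L ∸ suc s) (≤-reflexive (sym (m+[n∸m]≡n s<L))) ⟩
      suc (s / t + (L ∸ suc s) / t)           ≤⟨ s≤s (+-mono-≤ (/-monoˡ-≤ t left) (/-monoˡ-≤ t right)) ⟩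
      suc (level s + level (L + C + s))       ∎))
      where
      open ≤-Reasoning
      left : s ≤ depth s
      left = ≤-depth ≤-refl (begin
        s + suc s       ≤⟨ +-mono-≤ (<⇒≤ s<L) s<L ⟩
        L + L           ≤⟨ +-monoˡ-≤ L (m≤m+n L C) ⟩
        L + C + L       ≡⟨ N≡L+C+L ⟨
        N               ∎)
      right : L ∸ suc s ≤ depth (L + C + s)
      right = ≤-depth (≤-trans (m∸n≤m L (suc s)) (≤-trans (m≤m+n L C) (m≤m+n (L + C) s))) (≤-reflexive (begin-equality
        (L ∸ suc s) + suc (L + C + s)     ≡⟨ cong ((L ∸ suc s) +_) (+-suc (L + C) s) ⟨
        (L ∸ suc s) + (L + C + suc s)     ≡⟨ swap (L ∸ suc s) (L + C) (suc s) ⟩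
        L + C + ((L ∸ suc s) + suc s)     ≡⟨ cong ((L + C) +_) (m∸n+n≡m s<L) ⟩
        L + C + L                         ≡⟨ N≡L+C+L ⟨
        N                                 ∎))
        where
        swap : ∀ x y z → x + (y + z) ≡ y + (x + z)
        swap = ℕ-Solver.solve-∀

    middle-weight : ∀ s → s < C → suc (2 * m) ≤ weight (L + s)
    middle-weight s s<C = s≤s (*-monoʳ-≤ 2 (begin
      m                 ≡⟨ m*n/n≡m m t ⟨
      L / t             ≤⟨ /-monoˡ-≤ t (≤-depth (m≤m+n L s) L+1+L+s≤N) ⟩
      level (L + s)     ∎))
      where
      open ≤-Reasoning
      L+1+L+s≤N : L + suc (L + s) ≤ N
      L+1+L+s≤N = begin
        L + suc (L + s)     ≡⟨ cong (L +_) (+-suc L s) ⟨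
        L + (L + suc s)     ≤⟨ +-monoʳ-≤ L (+-monoʳ-≤ L s<C) ⟩
        L + (L + C)         ≡⟨ +-comm L (L + C) ⟩
        L + C + L           ≡⟨ N≡L+C+L ⟨
        N                   ∎

    weight-sum-bound : L * (2 * m) + C * suc (2 * m) ≤ sumUpTo N weight
    weight-sum-bound = begin
      L * (2 * m) + C * suc (2 * m)
        ≤⟨ +-mono-≤ (n*a≤sumUpTo L _ _ outer-weights) (n*a≤sumUpTo C _ _ middle-weight) ⟩
      sumUpTo L (λ s → weight s + weight (L + C + s)) + sumUpTo C (λ s → weight (L + s))
        ≡⟨ cong (_+ sumUpTo C (λ s → weight (L + s))) (sumUpTo-distrib-+ L weight (λ s → weight (L + C + s))) ⟩
      sumUpTo L weight + sumUpTo L (λ s → weight (L + C + s)) + sumUpTo C (λ s → weight (L + s))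
        ≡⟨ swap₂₃ (sumUpTo L weight) _ _ ⟩
      sumUpTo L weight + sumUpTo C (λ s → weight (L + s)) + sumUpTo L (λ s → weight (L + C + s))
        ≡⟨ cong (_+ sumUpTo L (λ s → weight (L + C + s))) (sumUpTo-+ L C weight) ⟨
      sumUpTo (L + C) weight + sumUpTo L (λ s → weight (L + C + s))
        ≡⟨ sumUpTo-+ (L + C) L weight ⟨
      sumUpTo (L + C + L) weight
        ≡⟨ cong (λ n → sumUpTo n weight) N≡L+C+L ⟨
      sumUpTo N weight  ∎
      where
      open ≤-Reasoning
      swap₂₃ : ∀ x y z → x + y + z ≡ x + z + y
      swap₂₃ = ℕ-Solver.solve-∀

  weight-total : t * (k * k) + 1 + 2 * k ≤ 2 * sumUpTo N weight
  weight-total = begin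
    t * (k * k) + 1 + 2 * k                      ≡⟨ cong (λ x → t * (x * x) + 1 + 2 * x) (m≡m%n+[m/n]*n k 2) ⟩
    t * ((b + m * 2) * (b + m * 2)) + 1 + 2 * (b + m * 2)
                                                 ≤⟨ parity-arith m b t (m%n<n k 2) (>-nonZero⁻¹ t) ⟩
    2 * (L * (2 * m) + C * suc (2 * m))          ≤⟨ *-monoʳ-≤ 2 weight-sum-bound ⟩
    2 * sumUpTo N weight                         ∎
    where open ≤-Reasoning

  module _ (c : ℤ → ℕ) (radio : IsRadioLabeling (DistAdj (oneTo t)) k c) where

    <⇒weights≤2∣c-c∣ : ∀ {i j} → i < j → j < N → weight i + weight j ≤ 2 * ∣ c (ℤ.+ i) - c (ℤ.+ j) ∣
    <⇒weights≤2∣c-c∣ {i} {j} i<j j<N =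
      subst (_≤ 2 * ∣ c (ℤ.+ i) - c (ℤ.+ j) ∣) (sym (weight-+ i j)) (*-monoʳ-≤ 2 levels<∣c-c∣)
      where
      s = level i + level j
      r = k ∸ s
      s+r≡k : s + r ≡ k
      s+r≡k = m+[n∸m]≡n (<⇒≤ (levels<k i<j j<N))
      j∸i≤r*t : j ∸ i ≤ r * t
      j∸i≤r*t = +-cancelˡ-≤ (s * t) _ _ (begin
        s * t + (j ∸ i)     ≤⟨ levels-apart i<j j<N ⟩
        k * t               ≡⟨ cong (_* t) s+r≡k ⟨
        (s + r) * t         ≡⟨ *-distribʳ-+ t s r ⟩
        s * t + r * t       ∎)
        where open ≤-Reasoning
      levels<∣c-c∣ : suc s ≤ ∣ c (ℤ.+ i) - c (ℤ.+ j) ∣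
      levels<∣c-c∣ = +-cancelʳ-≤ r _ _ (begin
        suc s + r                                ≡⟨ cong suc s+r≡k ⟩
        suc k                                    ≡⟨ +-comm 1 k ⟩
        k + 1                                    ≤⟨ radio-forward t c radio i r (m<n⇒0<n∸m i<j) j∸i≤r*t ⟩
        ∣ c (ℤ.+ i) - c (ℤ.+ (i + (j ∸ i))) ∣ + r  ≡⟨ cong (λ z → ∣ c (ℤ.+ i) - c (ℤ.+ z) ∣ + r) (m+[n∸m]≡n (<⇒≤ i<j)) ⟩
        ∣ c (ℤ.+ i) - c (ℤ.+ j) ∣ + r              ∎)
        where open ≤-Reasoning

    ≢⇒weights≤2∣c-c∣ : ∀ {i j} → i < N → j < N → i ≢ j → weight i + weight j ≤ 2 * ∣ c (ℤ.+ i) - c (ℤ.+ j) ∣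
    ≢⇒weights≤2∣c-c∣ = wlog-< (λ i j → weight i + weight j ≤ 2 * ∣ c (ℤ.+ i) - c (ℤ.+ j) ∣)
      (λ {i} {j} → subst₂ _≤_ (+-comm (weight i) (weight j)) (cong (2 *_) (∣-∣-comm (c (ℤ.+ i)) (c (ℤ.+ j)))))
      <⇒weights≤2∣c-c∣

proposition1 : ∀ (k t : ℕ) → 1 ≤ k → 2 ≤ t → (c : ℤ → ℕ) →
    IsRadioLabeling (DistAdj (oneTo t)) k c →
    SpanAtLeastHalf c (t * (k * k) + 1)
proposition1 k t 1≤k (s≤s _) c radio =
  conclude (label-spread label weight (upTo N) separated (upTo⁺ N) 2≤∣window∣)
  where
  open Window k t
  label : ℕ → ℕ
  label i = c (ℤ.+ i)
  separated : ∀ {u v} → u ∈ upTo N → v ∈ upTo N → u ≢ v → weight u + weight v ≤ 2 * ∣ label u - label v ∣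
  separated u∈ v∈ = ≢⇒weights≤2∣c-c∣ c radio (∈-upTo⁻ u∈) (∈-upTo⁻ v∈)
  2≤∣window∣ : 2 ≤ length (upTo N)
  2≤∣window∣ = subst (2 ≤_) (sym (length-upTo N)) (s≤s (*-mono-≤ 1≤k (s≤s z≤n)))
  conclude : Spread label weight (upTo N) → SpanAtLeastHalf c (t * (k * k) + 1)
  conclude (x , y , x≢y , x∈ , y∈ , spread) = ℤ.+ x , ℤ.+ y , +-cancelʳ-≤ (2 * k) _ _ (begin
    2 * label y + (t * (k * k) + 1) + 2 * k   ≡⟨ +-assoc (2 * label y) _ (2 * k) ⟩
    2 * label y + (t * (k * k) + 1 + 2 * k)   ≤⟨ +-monoʳ-≤ (2 * label y) weight-total ⟩
    2 * label y + 2 * sumUpTo N weight        ≤⟨ spread ⟩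
    2 * label x + weight x + weight y         ≡⟨ +-assoc (2 * label x) (weight x) (weight y) ⟩
    2 * label x + (weight x + weight y)       ≤⟨ +-monoʳ-≤ (2 * label x) (≢⇒weights≤2k (∈-upTo⁻ x∈) (∈-upTo⁻ y∈) x≢y) ⟩
    2 * label x + 2 * k                       ∎)
    where open ≤-Reasoning
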